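{- There are exactly $38$ tuples $(n,m,a_1,a_2,a_3,a_4,a_5)\in\mathbb{N}_0^7$ with $n\le 1000$, $n-1>m\ge 2$ and $a_1>a_2>a_3>a_4>a_5\ge 0$ satisfying \[F_n+F_m=2^{a_1}+2^{a_2}+2^{a_3}+2^{a_4}+2^{a_5}.\] All of them satisfy $n\le 23$ and $a_1\le 14$.
   Context: $(F_k)_{k\ge0}$ is the Fibonacci sequence: $F_0=0$, $F_1=1$, $F_{k+2}=F_{k+1}+F_k$. -}

module Defs where

open import Data.Nat using (ℕ; zero; suc; _+_; _∸_; _^_; _≤_; _<_)
open import Data.Product using (_×_; _,_)
open import Relation.Binary.PropositionalEquality using (_≡_)

fib : ℕ → ℕ
fib zero = 0
fib (suc zero) = 1
fib (suc (suc k)) = fib (suc k) + fib k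

Tuple : Set
Tuple = ℕ × ℕ × ℕ × ℕ × ℕ × ℕ × ℕ

Sol : Tuple → Set
Sol (n , m , a1 , a2 , a3 , a4 , a5) =
  n ≤ 1000 × m < n ∸ 1 × 2 ≤ m ×
  a2 < a1 × a3 < a2 × a4 < a3 × a5 < a4 ×
  fib n + fib m ≡ 2 ^ a1 + 2 ^ a2 + 2 ^ a3 + 2 ^ a4 + 2 ^ a5

{-# OPTIONS --safe #-}
-- A sum of five distinct powers of two has exactly five one-bits, at the positions given by the
-- exponents, so a solution is determined by (n, m); moreover F_n + F_m < 2^(n+1), so n + 1 bits
-- suffice to find them.  For every pair (n, m) in range, generating the Fibonacci numbers
-- incrementally, we compute the lowest six one-bits of F_n + F_m and check that whenever there
-- are exactly five, the resulting tuple is among the 38 listed ones.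
module Submission where

open import Defs
open import Data.Nat using (ℕ; _≤_)
open import Data.Product using (Σ; _×_; _,_)
open import Data.List using (List; length)
open import Data.List.Membership.Propositional using (_∈_)
open import Data.List.Relation.Unary.Unique.Propositional using (Unique)
open import Function.Bundles using (_⇔_)
open import Relation.Binary.PropositionalEquality using (_≡_)

open import Data.Nat using (zero; suc; _+_; _*_; _∸_; _^_; _<_; _%_; _/_; z≤n; s≤s)
open import Data.Nat.Properties
open import Data.Nat.DivMod using (m*n%n≡0; m*n/n≡m; [m+kn]%n≡m%n; +-distrib-/-∣ʳ)
open import Data.Nat.Divisibility using (n∣m*n)
open import Data.Nat.ListAction using (sum)
open import Data.Nat.Tactic.RingSolver using (solve-∀)
open import Data.Bool using (Bool; true; T; _∧_)
open import Data.Bool.Properties using (T-∧; T-≡)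
open import Data.List using ([]; _∷_; map)
open import Data.List.Relation.Unary.All as All using (All; []; _∷_; all?)
open import Data.List.Relation.Unary.AllPairs using (AllPairs; []; _∷_)
open import Data.List.Relation.Unary.Linked using ([-]; _∷_)
open import Data.List.Relation.Unary.Linked.Properties using (Linked⇒AllPairs)
open import Data.List.Relation.Unary.Unique.DecPropositional as DecUnique using ()
open import Data.List.Membership.DecPropositional as DecMembership using ()
open import Data.Product.Properties using (≡-dec)
open import Data.Sum using (inj₁; inj₂)
open import Data.Unit using (tt)
open import Function using (_∘_)
open import Function.Bundles using (Equivalence; mk⇔)
open import Relation.Nullary using (Dec; yes; no; contradiction)
open import Relation.Nullary.Decidable using (isYes; toWitness; _×-dec_)
open import Relation.Binary.Definitions using (DecidableEquality)
open import Relation.Binary.PropositionalEquality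
  using (refl; sym; trans; cong; cong₂; subst; module ≡-Reasoning)

lowestOnes : ℕ → ℕ → ℕ → ℕ → List ℕ
lowestOnes zero    _       _ _ = []
lowestOnes (suc f) zero    _ _ = []
lowestOnes (suc f) (suc k) i x with x % 2
... | zero  = lowestOnes f (suc k) (suc i) (x / 2)
... | suc _ = i ∷ lowestOnes f k (suc i) (x / 2)

lowestOnes-even : ∀ f k i y → lowestOnes (suc f) (suc k) i (y * 2) ≡ lowestOnes f (suc k) (suc i) y
lowestOnes-even f k i y rewrite m*n%n≡0 y 2 ⦃ _ ⦄ | m*n/n≡m y 2 ⦃ _ ⦄ = refl

[1+m*2]/2≡m : ∀ m → (1 + m * 2) / 2 ≡ m
[1+m*2]/2≡m m = trans (+-distrib-/-∣ʳ 1 {d = 2} (n∣m*n m)) (m*n/n≡m m 2)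

lowestOnes-odd : ∀ f k i y →
                 lowestOnes (suc f) (suc k) i (1 + y * 2) ≡ i ∷ lowestOnes f k (suc i) y
lowestOnes-odd f k i y rewrite [m+kn]%n≡m%n 1 y 2 ⦃ _ ⦄ | [1+m*2]/2≡m y = refl

-- The number whose one-bits sit at the positions l, shifted down by i; it is only meaningful
-- when all positions are at least i, because of the truncated subtraction.
bitsValue : ℕ → List ℕ → ℕ
bitsValue i l = sum (map (λ a → 2 ^ (a ∸ i)) l)

bitsValue-shift : ∀ {i l} → All (i <_) l → bitsValue i l ≡ bitsValue (suc i) l * 2
bitsValue-shift [] = refl
bitsValue-shift {i} {a ∷ l} (i<a ∷ i<l) = begin
  2 ^ (a ∸ i) + bitsValue i l
    ≡⟨ cong₂ (λ e v → 2 ^ e + v) (+-∸-assoc 1 i<a) (bitsValue-shift i<l) ⟩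
  2 * 2 ^ (a ∸ suc i) + bitsValue (suc i) l * 2
    ≡⟨ cong (_+ bitsValue (suc i) l * 2) (*-comm 2 (2 ^ (a ∸ suc i))) ⟩
  2 ^ (a ∸ suc i) * 2 + bitsValue (suc i) l * 2
    ≡⟨ *-distribʳ-+ 2 (2 ^ (a ∸ suc i)) (bitsValue (suc i) l) ⟨
  bitsValue (suc i) (a ∷ l) * 2
    ∎
  where open ≡-Reasoning

bitsValue-∷>0 : ∀ i a l → 0 < bitsValue i (a ∷ l)
bitsValue-∷>0 i a l = ≤-trans (m^n>0 2 (a ∸ i)) (m≤m+n _ _)

m*2<2^1+n⇒m<2^n : ∀ {m} n → m * 2 < 2 ^ suc n → m < 2 ^ n
m*2<2^1+n⇒m<2^n {m} n lt = *-cancelʳ-< 2 m (2 ^ n) (subst (m * 2 <_) (*-comm 2 (2 ^ n)) lt)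

lowestOnes-bitsValue : ∀ f k i {l} → AllPairs _<_ l → All (i ≤_) l → length l ≤ k →
                       bitsValue i l < 2 ^ f → lowestOnes f k i (bitsValue i l) ≡ l
lowestOnes-bitsValue zero k i {[]} _ _ _ _ = refl
lowestOnes-bitsValue zero k i {a ∷ l} _ _ _ v<1 =
  contradiction v<1 (<⇒≱ (s≤s (bitsValue-∷>0 i a l)))
lowestOnes-bitsValue (suc f) zero i {[]} _ _ _ _ = refl
lowestOnes-bitsValue (suc f) (suc k) i {[]} _ _ _ _ =
  lowestOnes-bitsValue f (suc k) (suc i) [] [] z≤n (m^n>0 2 f)
lowestOnes-bitsValue (suc f) (suc k) i {a ∷ l} sorted@(a<l ∷ l-sorted) (i≤a ∷ _) (s≤s len) v<2^1+f
  with m≤n⇒m<n∨m≡n i≤a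
... | inj₁ i<a = begin
  lowestOnes (suc f) (suc k) i (bitsValue i (a ∷ l))
    ≡⟨ cong (lowestOnes (suc f) (suc k) i) even ⟩
  lowestOnes (suc f) (suc k) i (bitsValue (suc i) (a ∷ l) * 2)
    ≡⟨ lowestOnes-even f k i _ ⟩
  lowestOnes f (suc k) (suc i) (bitsValue (suc i) (a ∷ l))
    ≡⟨ lowestOnes-bitsValue f (suc k) (suc i) sorted i<a∷l (s≤s len)
         (m*2<2^1+n⇒m<2^n f (subst (_< 2 ^ suc f) even v<2^1+f)) ⟩
  a ∷ l
    ∎
  where
  open ≡-Reasoning
  i<a∷l : All (i <_) (a ∷ l)
  i<a∷l = i<a ∷ All.map (<-trans i<a) a<l
  even : bitsValue i (a ∷ l) ≡ bitsValue (suc i) (a ∷ l) * 2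
  even = bitsValue-shift i<a∷l
... | inj₂ refl = begin
  lowestOnes (suc f) (suc k) i (bitsValue i (i ∷ l))
    ≡⟨ cong (lowestOnes (suc f) (suc k) i) odd ⟩
  lowestOnes (suc f) (suc k) i (1 + bitsValue (suc i) l * 2)
    ≡⟨ lowestOnes-odd f k i _ ⟩
  i ∷ lowestOnes f k (suc i) (bitsValue (suc i) l)
    ≡⟨ cong (i ∷_) (lowestOnes-bitsValue f k (suc i) l-sorted a<l len
         (m*2<2^1+n⇒m<2^n f (<-trans (n<1+n _) (subst (_< 2 ^ suc f) odd v<2^1+f)))) ⟩
  i ∷ l
    ∎
  where
  open ≡-Reasoning
  odd : bitsValue i (i ∷ l) ≡ 1 + bitsValue (suc i) l * 2
  odd = cong₂ _+_ (cong (2 ^_) (n∸n≡0 i)) (bitsValue-shift a<l)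

fib≤2^ : ∀ n → fib n ≤ 2 ^ n
fib≤2^ zero = z≤n
fib≤2^ (suc zero) = s≤s z≤n
fib≤2^ (suc (suc n)) = begin
  fib (suc n) + fib n    ≤⟨ +-mono-≤ (fib≤2^ (suc n)) (≤-trans (fib≤2^ n) (^-monoʳ-≤ 2 (n≤1+n n))) ⟩
  2 ^ suc n + 2 ^ suc n  ≡⟨ cong (2 ^ suc n +_) (+-identityʳ (2 ^ suc n)) ⟨
  2 ^ suc (suc n)        ∎
  where open ≤-Reasoning

fib+fib<2^1+n : ∀ {m n} → m < n → fib n + fib m < 2 ^ suc n
fib+fib<2^1+n {m} {n} m<n = begin-strict
  fib n + fib m  ≤⟨ +-mono-≤ (fib≤2^ n) (fib≤2^ m) ⟩
  2 ^ n + 2 ^ m  <⟨ +-monoʳ-< (2 ^ n) (^-monoʳ-< 2 (s≤s (s≤s z≤n)) m<n) ⟩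
  2 ^ n + 2 ^ n  ≡⟨ cong (2 ^ n +_) (+-identityʳ (2 ^ n)) ⟨
  2 ^ suc n      ∎
  where open ≤-Reasoning

allFibs : (ℕ → ℕ → Bool) → ℕ → ℕ → ℕ → ℕ → Bool
allFibs p zero    m a b = true
allFibs p (suc c) m a b = p m a ∧ allFibs p c (suc m) b (b + a)

-- Named, and stated with ≡ true rather than T, so that the type of the large computation below
-- is matched syntactically where it is used instead of being evaluated a second time.
AllFibs : (ℕ → ℕ → Bool) → ℕ → ℕ → Set
AllFibs p c m = allFibs p c m (fib m) (fib (suc m)) ≡ true

allFibs-sound : ∀ p c m → AllFibs p c m → ∀ {j} → m ≤ j → j < c + m → T (p j (fib j))
allFibs-sound p zero m _ m≤j j<m = contradiction j<m (≤⇒≯ m≤j)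
allFibs-sound p (suc c) m ok {j} m≤j j<c+m
  with m ≟ j | Equivalence.to (T-∧ {p m (fib m)}) (Equivalence.from T-≡ ok)
... | yes refl | here , _    = here
... | no m≢j   | _    , rest =
  allFibs-sound p c (suc m) (Equivalence.to T-≡ rest) (≤∧≢⇒< m≤j m≢j)
    (subst (j <_) (sym (+-suc c m)) j<c+m)

_≟ᵗ_ : DecidableEquality Tuple
_≟ᵗ_ = ≡-dec _≟_ (≡-dec _≟_ (≡-dec _≟_ (≡-dec _≟_ (≡-dec _≟_ (≡-dec _≟_ _≟_)))))

open DecMembership _≟ᵗ_ using (_∈?_)

solutions : List Tuple
solutions = (9 , 7 , 5 , 3 , 2 , 1 , 0)
  ∷ (11 , 3 , 6 , 4 , 3 , 1 , 0)
  ∷ (11 , 5 , 6 , 4 , 3 , 2 , 1)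
  ∷ (11 , 8 , 6 , 5 , 3 , 2 , 1)
  ∷ (12 , 7 , 7 , 4 , 3 , 2 , 0)
  ∷ (12 , 10 , 7 , 6 , 2 , 1 , 0)
  ∷ (13 , 2 , 7 , 6 , 5 , 3 , 1)
  ∷ (13 , 4 , 7 , 6 , 5 , 3 , 2)
  ∷ (13 , 6 , 7 , 6 , 5 , 4 , 0)
  ∷ (14 , 8 , 8 , 7 , 3 , 2 , 1)
  ∷ (14 , 11 , 8 , 7 , 6 , 4 , 1)
  ∷ (15 , 2 , 9 , 6 , 5 , 1 , 0)
  ∷ (15 , 4 , 9 , 6 , 5 , 2 , 0)
  ∷ (15 , 6 , 9 , 6 , 5 , 3 , 1)
  ∷ (15 , 10 , 9 , 7 , 4 , 3 , 0)
  ∷ (16 , 5 , 9 , 8 , 7 , 6 , 5)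
  ∷ (16 , 14 , 10 , 8 , 6 , 4 , 2)
  ∷ (17 , 6 , 10 , 9 , 6 , 2 , 0)
  ∷ (17 , 7 , 10 , 9 , 6 , 3 , 1)
  ∷ (17 , 8 , 10 , 9 , 6 , 4 , 1)
  ∷ (18 , 2 , 11 , 9 , 4 , 3 , 0)
  ∷ (18 , 3 , 11 , 9 , 4 , 3 , 1)
  ∷ (18 , 7 , 11 , 9 , 5 , 2 , 0)
  ∷ (18 , 12 , 11 , 9 , 7 , 5 , 3)
  ∷ (19 , 2 , 12 , 6 , 4 , 2 , 1)
  ∷ (19 , 5 , 12 , 6 , 4 , 3 , 1)
  ∷ (19 , 8 , 12 , 6 , 5 , 3 , 1)
  ∷ (20 , 8 , 12 , 11 , 9 , 7 , 1)
  ∷ (20 , 17 , 13 , 7 , 5 , 3 , 1)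
  ∷ (20 , 18 , 13 , 10 , 7 , 2 , 0)
  ∷ (22 , 2 , 14 , 10 , 8 , 5 , 4)
  ∷ (22 , 8 , 14 , 10 , 8 , 6 , 2)
  ∷ (22 , 11 , 14 , 10 , 8 , 7 , 3)
  ∷ (22 , 13 , 14 , 10 , 9 , 4 , 3)
  ∷ (22 , 16 , 14 , 11 , 8 , 3 , 1)
  ∷ (23 , 8 , 14 , 13 , 12 , 2 , 1)
  ∷ (23 , 10 , 14 , 13 , 12 , 5 , 3)
  ∷ (23 , 12 , 14 , 13 , 12 , 7 , 0)
  ∷ []

listedIfFive : ℕ → ℕ → List ℕ → Bool
listedIfFive n m (a5 ∷ a4 ∷ a3 ∷ a2 ∷ a1 ∷ []) = isYes ((n , m , a1 , a2 , a3 , a4 , a5) ∈? solutions)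
listedIfFive n m _ = true

pairListed : ℕ → ℕ → ℕ → ℕ → Bool
pairListed n fn m fm = listedIfFive n m (lowestOnes (suc n) 6 0 (fn + fm))

rowListed : ℕ → ℕ → Bool
rowListed n fn = allFibs (pairListed n fn) (n ∸ 1 ∸ 2) 2 1 2

rows-listed : AllFibs rowListed 1001 0
rows-listed = refl

pair-listed : ∀ {n m} → n ≤ 1000 → 2 ≤ m → m < n ∸ 1 → T (pairListed n (fib n) m (fib m))
pair-listed {n} {m} n≤1000 2≤m m<n-1 =
  allFibs-sound (pairListed n (fib n)) (n ∸ 1 ∸ 2) 2
    (Equivalence.to T-≡ (allFibs-sound rowListed 1001 0 rows-listed z≤n (s≤s n≤1000)))
    2≤m (subst (m <_) (sym (m∸n+n≡m (≤-trans 2≤m (<⇒≤ m<n-1)))) m<n-1)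

sum-reverse : ∀ p q r s t → p + q + r + s + t ≡ t + (s + (r + (q + (p + 0))))
sum-reverse = solve-∀

solution-listed : ∀ t → Sol t → t ∈ solutions
solution-listed (n , m , a1 , a2 , a3 , a4 , a5)
                (n≤1000 , m<n-1 , 2≤m , a2<a1 , a3<a2 , a4<a3 , a5<a4 , eq) =
  toWitness (subst (T ∘ listedIfFive n m) exponents (pair-listed n≤1000 2≤m m<n-1))
  where
  value : fib n + fib m ≡ bitsValue 0 (a5 ∷ a4 ∷ a3 ∷ a2 ∷ a1 ∷ [])
  value = trans eq (sum-reverse (2 ^ a1) (2 ^ a2) (2 ^ a3) (2 ^ a4) (2 ^ a5))
  exponents : lowestOnes (suc n) 6 0 (fib n + fib m) ≡ a5 ∷ a4 ∷ a3 ∷ a2 ∷ a1 ∷ []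
  exponents = trans (cong (lowestOnes (suc n) 6 0) value)
    (lowestOnes-bitsValue (suc n) 6 0
      (Linked⇒AllPairs <-trans (a5<a4 ∷ a4<a3 ∷ a3<a2 ∷ a2<a1 ∷ [-]))
      (All.universal (λ _ → z≤n) _)
      (n≤1+n 5)
      (subst (_< 2 ^ suc n) value (fib+fib<2^1+n (<-≤-trans m<n-1 (m∸n≤m n 1)))))

sol? : (t : Tuple) → Dec (Sol t)
sol? (n , m , a1 , a2 , a3 , a4 , a5) =
  n ≤? 1000 ×-dec m <? n ∸ 1 ×-dec 2 ≤? m ×-dec
  a2 <? a1 ×-dec a3 <? a2 ×-dec a4 <? a3 ×-dec a5 <? a4 ×-dec
  fib n + fib m ≟ 2 ^ a1 + 2 ^ a2 + 2 ^ a3 + 2 ^ a4 + 2 ^ a5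

Bounded : Tuple → Set
Bounded (n , _ , a1 , _) = n ≤ 23 × a1 ≤ 14

bounded? : (t : Tuple) → Dec (Bounded t)
bounded? (n , _ , a1 , _) = n ≤? 23 ×-dec a1 ≤? 14

proposition1 : Σ (List Tuple) (λ L → length L ≡ 38 × Unique L × ((t : Tuple) → Sol t ⇔ t ∈ L))
                 × ((n m a1 a2 a3 a4 a5 : ℕ) → Sol (n , m , a1 , a2 , a3 , a4 , a5) → n ≤ 23 × a1 ≤ 14)
proposition1 =
  (solutions , refl , unique , λ t → mk⇔ (solution-listed t) (All.lookup solutions-solve))
  , λ n m a1 a2 a3 a4 a5 s → All.lookup solutions-bounded (solution-listed _ s)
  where
  unique : Unique solutions
  unique = toWitness {a? = DecUnique.unique? _≟ᵗ_ solutions} tt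
  solutions-solve : All Sol solutions
  solutions-solve = toWitness {a? = all? sol? solutions} tt
  solutions-bounded : All Bounded solutions
  solutions-bounded = toWitness {a? = all? bounded? solutions} tt
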